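{- Let $m\ge 2$, $n\ge1$, $\pi\in\mathcal{S}_n$ and $\sigma=\Phi_m(\pi)$. Then ${\sf a}_m(\pi)={\sf b}_m(\sigma)$.
   Context: For $\tau\in\mathcal{S}_m$, an occurrence of $\tau$ in $\pi\in\mathcal{S}_n$ is a sequence $1\le i_1<\dots<i_m\le n$ such that $\pi_{i_1}\cdots\pi_{i_m}$ is order-isomorphic to $\tau$. Let $A_m=\{\tau\in\mathcal{S}_m:\tau_{m-1}=m,\ \tau_m=m-1\}$ and $B_m=\{\tau\in\mathcal{S}_m:\tau_{m-1}=m-1,\ \tau_m=m\}$. ${\sf a}_m(\pi)$ (resp. ${\sf b}_m(\pi)$) is the number of distinct pairs $(i,j)$, $1\le i<j\le n$, such that $i,j$ are the final two terms of some occurrence in $\pi$ of some pattern belonging to $A_m$ (resp. $B_m$). Diagram squares: the pairs $(i,j)$ with $j<\pi_i$ and $\pi^{ -1}(j)>i$ (cells in row $i$, column $j$ of the $n\times n$ array with dots at $(i,\pi_i)$ left unshaded after shading each dot and all cells due south and due east of it); the rank of $(i,j)$ is $|\{k<i:\pi_k<j\}|$. The map $\Phi_m:\mathcal{S}_n\to\mathcal{S}_n$ is defined as follows. Call position $i$ kept if $|\{k<i:\pi_k<\pi_i\}|\le m-3$, and set $\sigma_i=\pi_i$ for every kept position $i$. Let $r_1<\dots<r_s$ be the non-kept positions and $c_1>\dots>c_s$ the values not of the form $\pi_i$ with $i$ kept. For each $t$, let $e_t$ be the number of diagram squares of $\pi$ in row $r_t$ having rank at least $m-2$. For $t=1,\dots,s$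 in turn: set $\sigma_{r_t}$ equal to the $(e_t+1)$-st largest of the values among $c_1,\dots,c_s$ not yet used. Equivalently, $\sigma=\Phi_m(\pi)$ is the permutation whose diagram squares of rank at most $m-3$ coincide with those of $\pi$ and such that, for each $i$, the number of pairs $(i,j)$ which are the final two terms of an occurrence of a pattern of $B_m$ in $\sigma$ equals the number of diagram squares of $\pi$ in row $i$ of rank at least $m-2$. -}

module Defs where

open import Data.Bool.Base using (Bool; true; false; if_then_else_; _∧_; not)
open import Data.Nat.Base using (ℕ; zero; suc; _+_; _<_; _≡ᵇ_; _<ᵇ_; _≤ᵇ_)
open import Data.Fin.Base using (Fin; toℕ)
open import Data.Fin.Permutation using (Permutation′; _⟨$⟩ʳ_; _⟨$⟩ˡ_)
open import Data.List.Base using (List; []; _∷_; length; map; filterᵇ; allFin; reverse)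
open import Data.List.Membership.Propositional using (_∈_)
open import Data.List.Relation.Unary.Unique.Propositional using (Unique)
open import Data.Bool.ListAction using (any)
open import Data.Maybe.Base using (Maybe; just; nothing)
open import Data.Product.Base using (Σ; ∃; _×_; _,_)
open import Function.Bundles using (_⇔_)
open import Relation.Binary.PropositionalEquality using (_≡_)

-- Conventions: positions and values are 0-indexed (Fin n).  A sequence
-- of length n is a function Fin n → ℕ; a permutation π ∈ S_n is read as
-- the sequence i ↦ toℕ (π ⟨$⟩ʳ i).

seq : ∀ {n} → Permutation′ n → Fin n → ℕ
seq π i = toℕ (π ⟨$⟩ʳ i)

Occurrence : ∀ {m n} → (Fin n → ℕ) → Permutation′ m → (Fin m → Fin n) → Set
Occurrence w τ f =
  (∀ a b → toℕ a < toℕ b → toℕ (f a) < toℕ (f b)) ×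
  (∀ a b → (w (f a) < w (f b)) ⇔ (toℕ (τ ⟨$⟩ʳ a) < toℕ (τ ⟨$⟩ʳ b)))

-- τ ∈ A_m :  τ_{m-1} = m and τ_m = m-1   (1-indexed, as in the paper)
InA : (m : ℕ) → Permutation′ m → Set
InA m τ =
  (∀ a → suc (toℕ a) + 1 ≡ m → suc (toℕ (τ ⟨$⟩ʳ a)) ≡ m) ×
  (∀ a → suc (toℕ a) ≡ m → suc (toℕ (τ ⟨$⟩ʳ a)) + 1 ≡ m)

-- τ ∈ B_m :  τ_{m-1} = m-1 and τ_m = m
InB : (m : ℕ) → Permutation′ m → Set
InB m τ =
  (∀ a → suc (toℕ a) + 1 ≡ m → suc (toℕ (τ ⟨$⟩ʳ a)) + 1 ≡ m) ×
  (∀ a → suc (toℕ a) ≡ m → suc (toℕ (τ ⟨$⟩ʳ a)) ≡ m)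

FinalTwo : ∀ {m n} → (Fin m → Fin n) → Fin n → Fin n → Set
FinalTwo {m} f i j =
  (∀ a → suc (toℕ a) + 1 ≡ m → f a ≡ i) ×
  (∀ a → suc (toℕ a) ≡ m → f a ≡ j)

PairOf : (m : ℕ) → (Permutation′ m → Set) → ∀ {n} → (Fin n → ℕ) → Fin n × Fin n → Set
PairOf m C w (i , j) =
  toℕ i < toℕ j ×
  Σ (Permutation′ m) λ τ → C τ × Σ (Fin m → Fin _) λ f → Occurrence w τ f × FinalTwo f i j

APair BPair : (m : ℕ) → ∀ {n} → (Fin n → ℕ) → Fin n × Fin n → Set
APair m = PairOf m (InA m)
BPair m = PairOf m (InB m)

-- "the number of elements p with P p is k": an exhaustive duplicate-free list of length k
HasCount : ∀ {n} → (Fin n × Fin n → Set) → ℕ → Set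
HasCount {n} P k =
  Σ (List (Fin n × Fin n)) λ xs → Unique xs × (∀ p → (p ∈ xs) ⇔ P p) × length xs ≡ k

count : ∀ {n} → (Fin n → Bool) → ℕ
count {n} p = length (filterᵇ p (allFin n))

pickAt : ℕ → List ℕ → Maybe (ℕ × List ℕ)
pickAt _ [] = nothing
pickAt zero (x ∷ xs) = just (x , xs)
pickAt (suc e) (x ∷ xs) with pickAt e xs
... | just (y , ys) = just (y , x ∷ ys)
... | nothing = nothing

lookupAssoc : ∀ {n} → Fin n → List (Fin n × ℕ) → ℕ
lookupAssoc i [] = 0
lookupAssoc i ((r , v) ∷ rest) =
  if toℕ r ≡ᵇ toℕ i then v else lookupAssoc i rest

module PhiDef (m : ℕ) {n : ℕ} (π : Permutation′ n) where

  lowBefore : Fin n → ℕ → ℕ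
  lowBefore i v = count (λ k → (toℕ k <ᵇ toℕ i) ∧ (seq π k <ᵇ v))

  -- kept:  |{k<i : π_k < π_i}| ≤ m-3  (written additively, so nothing is kept when m = 2)
  kept : Fin n → Bool
  kept i = lowBefore i (seq π i) + 3 ≤ᵇ m

  isSquare : Fin n → Fin n → Bool
  isSquare i j = (toℕ j <ᵇ seq π i) ∧ (toℕ i <ᵇ toℕ (π ⟨$⟩ˡ j))

  rank : Fin n → Fin n → ℕ
  rank i j = lowBefore i (toℕ j)

  e : Fin n → ℕ
  e i = count (λ j → isSquare i j ∧ (m ≤ᵇ rank i j + 2))

  nonKept : List (Fin n)
  nonKept = filterᵇ (λ i → not (kept i)) (allFin n)

  freeVals : List ℕ
  freeVals = reverse (map toℕ (filterᵇ
    (λ v → not (any (λ i → kept i ∧ (seq π i ≡ᵇ toℕ v)) (allFin n)))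
    (allFin n)))

  -- for t = 1..s in turn, σ_{r_t} := the (e_t+1)-st largest unused value
  assign : List (Fin n) → List ℕ → List (Fin n × ℕ)
  assign [] cs = []
  assign (r ∷ rs) cs with pickAt (e r) cs
  ... | just (v , cs′) = (r , v) ∷ assign rs cs′
  ... | nothing = assign rs cs

  Φ : Fin n → ℕ
  Φ i = if kept i then seq π i else lookupAssoc i (assign nonKept freeVals)

Φ : (m : ℕ) → ∀ {n} → Permutation′ n → Fin n → ℕ
Φ m π = PhiDef.Φ m π

module Submission where

-- Write d = m - 2 and L b x for the number of entries before position b that are smaller than x.
-- (i , j) is an A-pair iff i < j, w j < w i and L i (w j) ≥ d, and a B-pair iff i < j, w i < w j and
-- L i (w i) ≥ d: those d smaller entries, followed by i and j, form the required occurrence.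
-- So the A-pairs of π in row i are the diagram squares of row i of rank ≥ d; there are e i of them,
-- and none when i is kept (L i (π i) < d).
-- Φ keeps these entries and fills the other positions i from left to right with the (e i + 1)-st
-- largest value left. An invariant comparing the values left with the positions left shows that each
-- filled value still has ≥ d smaller entries before it and is exceeded by exactly e i later values;
-- hence σ has the same kept positions as π, and e i B-pairs in each row i.

open import Level using (0ℓ)
open import Data.Bool.Base using (Bool; true; false; T; not; _∧_)
open import Data.Bool.ListAction using (any)
open import Data.Bool.Properties using (T-∧)
open import Data.Nat.Base
  using (ℕ; zero; suc; _+_; _<_; _≤_; _>_; _<ᵇ_; _≤ᵇ_; _≡ᵇ_; z≤n; s≤s; s≤s⁻¹)
open import Data.Nat.Properties
open import Data.Nat.Induction using (<-rec)
open import Data.Nat.ListAction using (sum)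
open import Data.Fin.Base using (Fin; zero; suc; toℕ; fromℕ; fromℕ<; inject₁; inject≤; punchIn; punchOut)
open import Data.Fin.Properties
  using (toℕ-injective; toℕ<n; toℕ-fromℕ; toℕ-fromℕ<; toℕ-inject₁; toℕ-inject≤; inject₁-injective;
         injective⇒≤; any?; punchIn-injective; punchInᵢ≢i; punchOut-injective)
  renaming (_≟_ to _≟ᶠ_)
open import Data.Fin.Permutation using (Permutation′; _⟨$⟩ʳ_; _⟨$⟩ˡ_; inverseˡ; inverseʳ; permutation)
import Data.Fin.Permutation as Permutation
open import Data.List.Base using (List; []; _∷_; _++_; length; map; filter; filterᵇ; allFin; lookup; reverse)
open import Data.List.Properties
  using (filter-accept; filter-reject; filter-notAll; length-filter; length-tabulate; length-++; length-map;
         map-cong; map-cong-local; unfold-reverse)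
open import Data.List.Membership.Propositional using (_∈_; _∉_; lose)
open import Data.List.Membership.Propositional.Properties
  using (∈-++⁻; ∈-++⁺ˡ; ∈-++⁺ʳ; ∈-map⁺; ∈-map⁻; ∈-filter⁺; ∈-filter⁻; ∈-allFin; ∈-lookup)
import Data.List.Membership.Setoid.Properties as SetoidMembership
open import Data.List.Relation.Unary.Any using (here; there; index; satisfied)
import Data.List.Relation.Unary.Any as Any
import Data.List.Relation.Unary.Any.Properties as Any
open import Data.List.Relation.Unary.Any.Properties using (any⇔)
import Data.List.Relation.Unary.All as All
open import Data.List.Relation.Unary.AllPairs using (AllPairs; []; _∷_)
import Data.List.Relation.Unary.AllPairs as AllPairs
import Data.List.Relation.Unary.AllPairs.Properties as AllPairs
open import Data.List.Relation.Unary.Unique.Propositional using (Unique)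
import Data.List.Relation.Unary.Unique.Propositional.Properties as Unique
open import Data.List.Relation.Binary.Permutation.Propositional
  using (_↭_; ↭-refl; ↭-reflexive; ↭-prep; ↭-swap; ↭-trans; ↭-sym; ↭⇒↭ₛ)
open import Data.List.Relation.Binary.Permutation.Propositional.Properties
  using (filter-↭; ↭-length; ↭-reverse; ∈-resp-↭)
open import Data.Maybe.Base using (just)
open import Data.Product.Base using (Σ; ∃; _×_; _,_; proj₁; proj₂; swap)
open import Data.Product.Function.NonDependent.Propositional using (_×-⇔_)
open import Data.Sum.Base using (inj₁; inj₂)
open import Data.Unit.Base using (⊤; tt)
open import Function.Base using (_∘_; _∘′_; id; flip)
open import Function.Bundles using (_⇔_; mk⇔; Equivalence)
open import Function.Properties.Equivalence using () renaming (trans to ⇔-trans; sym to ⇔-sym; refl to ⇔-refl)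
open import Relation.Binary.Definitions using (tri<; tri≈; tri>)
open import Relation.Binary.PropositionalEquality
open import Data.List.Relation.Binary.Permutation.Setoid.Properties (setoid ℕ) using (Unique-resp-↭)
open import Relation.Nullary using (¬_; Dec; yes; no; contradiction)
open import Relation.Nullary.Decidable using (T?; _×-dec_)
open import Relation.Unary using (Pred; Decidable)
open import Defs
  using (seq; Occurrence; InA; InB; FinalTwo; APair; BPair; HasCount; pickAt; lookupAssoc; module PhiDef; Φ)

private variable
  A B : Set

count : {P : Pred A 0ℓ} → Decidable P → List A → ℕ
count P? xs = length (filter P? xs)

module _ {P : Pred A 0ℓ} (P? : Decidable P) {x : A} {xs : List A} where

  count-accept : P x → count P? (x ∷ xs) ≡ suc (count P? xs)
  count-accept px = cong length (filter-accept P? px)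

  count-reject : ¬ P x → count P? (x ∷ xs) ≡ count P? xs
  count-reject ¬px = cong length (filter-reject P? ¬px)

count-≤-∷ : {P : Pred A 0ℓ} (P? : Decidable P) → ∀ x xs → count P? xs ≤ count P? (x ∷ xs)
count-≤-∷ P? x xs with P? x
... | yes _ = n≤1+n _
... | no _  = ≤-refl

count-mono : {P Q : Pred A 0ℓ} (P? : Decidable P) (Q? : Decidable Q) → ∀ xs → (∀ {x} → x ∈ xs → P x → Q x) →
             count P? xs ≤ count Q? xs
count-mono P? Q? []       P⊆Q = z≤n
count-mono P? Q? (x ∷ xs) P⊆Q with P? x
... | yes px = begin
  suc (count P? xs)  ≤⟨ s≤s (count-mono P? Q? xs (P⊆Q ∘ there)) ⟩
  suc (count Q? xs)  ≡⟨ count-accept Q? (P⊆Q (here refl) px) ⟨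
  count Q? (x ∷ xs)  ∎
  where open ≤-Reasoning
... | no _ = ≤-trans (count-mono P? Q? xs (P⊆Q ∘ there)) (count-≤-∷ Q? x xs)

count-cong : {P Q : Pred A 0ℓ} (P? : Decidable P) (Q? : Decidable Q) → ∀ xs →
             (∀ {x} → x ∈ xs → P x → Q x) → (∀ {x} → x ∈ xs → Q x → P x) →
             count P? xs ≡ count Q? xs
count-cong P? Q? xs P⊆Q Q⊆P = ≤-antisym (count-mono P? Q? xs P⊆Q) (count-mono Q? P? xs Q⊆P)

count-strict : {P Q : Pred A 0ℓ} (P? : Decidable P) (Q? : Decidable Q) → ∀ xs → (∀ {x} → x ∈ xs → P x → Q x) →
               ∀ {z} → z ∈ xs → Q z → ¬ P z → count P? xs < count Q? xs
count-strict P? Q? (x ∷ xs) P⊆Q (here refl) qx ¬px = begin-strict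
  count P? (x ∷ xs)  ≡⟨ count-reject P? ¬px ⟩
  count P? xs        ≤⟨ count-mono P? Q? xs (P⊆Q ∘ there) ⟩
  count Q? xs        <⟨ n<1+n _ ⟩
  suc (count Q? xs)  ≡⟨ count-accept Q? qx ⟨
  count Q? (x ∷ xs)  ∎
  where open ≤-Reasoning
count-strict P? Q? (x ∷ xs) P⊆Q (there z∈) qz ¬pz with P? x
... | yes px = begin-strict
  suc (count P? xs)  <⟨ s≤s (count-strict P? Q? xs (P⊆Q ∘ there) z∈ qz ¬pz) ⟩
  suc (count Q? xs)  ≡⟨ count-accept Q? (P⊆Q (here refl) px) ⟨
  count Q? (x ∷ xs)  ∎
  where open ≤-Reasoning
... | no _ = <-≤-trans (count-strict P? Q? xs (P⊆Q ∘ there) z∈ qz ¬pz) (count-≤-∷ Q? x xs)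

count-none : {P : Pred A 0ℓ} (P? : Decidable P) → ∀ xs → (∀ {x} → x ∈ xs → ¬ P x) → count P? xs ≡ 0
count-none P? []       ¬P = refl
count-none P? (x ∷ xs) ¬P = trans (count-reject P? (¬P (here refl))) (count-none P? xs (¬P ∘ there))

count-↭ : {P : Pred A 0ℓ} (P? : Decidable P) → ∀ {xs ys} → xs ↭ ys → count P? xs ≡ count P? ys
count-↭ P? = ↭-length ∘ filter-↭ P?

count-map : {P : Pred B 0ℓ} (P? : Decidable P) (f : A → B) → ∀ xs → count P? (map f xs) ≡ count (P? ∘ f) xs
count-map P? f []       = refl
count-map P? f (x ∷ xs) with P? (f x)
... | yes _ = cong suc (count-map P? f xs)
... | no _  = count-map P? f xs

lookup-injective : ∀ {xs : List A} → Unique xs → ∀ {a b} → lookup xs a ≡ lookup xs b → a ≡ b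
lookup-injective {xs = x ∷ xs} _          {zero}  {zero}  _ = refl
lookup-injective {xs = x ∷ xs} (x∉xs ∷ _) {zero}  {suc b} e = contradiction e (All.lookup x∉xs (∈-lookup b))
lookup-injective {xs = x ∷ xs} (x∉xs ∷ _) {suc a} {zero}  e = contradiction (sym e) (All.lookup x∉xs (∈-lookup a))
lookup-injective {xs = x ∷ xs} (_ ∷ !xs)  {suc a} {suc b} e = cong suc (lookup-injective !xs e)

count-≥-injection : {P : Pred A 0ℓ} (P? : Decidable P) → ∀ xs {k} (h : Fin k → A) → (∀ {a b} → h a ≡ h b → a ≡ b) →
                    (∀ a → h a ∈ xs) → (∀ a → P (h a)) → k ≤ count P? xs
count-≥-injection {A = A} P? xs h h-inj h∈xs P[h] =
  injective⇒≤ {f = index ∘ h∈filter} λ {a} {b} e →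
    h-inj (SetoidMembership.index-injective (setoid A) (h∈filter a) (h∈filter b) e)
  where
  h∈filter : ∀ a → h a ∈ filter P? xs
  h∈filter a = ∈-filter⁺ P? (h∈xs a) (P[h] a)

count-≤-injection : {P : Pred A 0ℓ} {Q : Pred B 0ℓ} (P? : Decidable P) (Q? : Decidable Q) → ∀ {xs ys} → Unique xs →
                    (f : A → B) → (∀ {x y} → f x ≡ f y → x ≡ y) →
                    (∀ {x} → x ∈ xs → P x → f x ∈ ys × Q (f x)) → count P? xs ≤ count Q? ys
count-≤-injection {Q = Q} P? Q? {xs} {ys} !xs f f-inj P⇒Q =
  count-≥-injection Q? ys (f ∘ lookup zs) (lookup-injective (Unique.filter⁺ P? !xs) ∘ f-inj)
    (proj₁ ∘ Q[f]) (proj₂ ∘ Q[f])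
  where
  zs = filter P? xs
  Q[f] : ∀ a → f (lookup zs a) ∈ ys × Q (f (lookup zs a))
  Q[f] a = let z∈xs , pz = ∈-filter⁻ P? (∈-lookup a) in P⇒Q z∈xs pz

⟨$⟩ʳ-injective : ∀ {n} (ρ : Permutation′ n) {x y} → ρ ⟨$⟩ʳ x ≡ ρ ⟨$⟩ʳ y → x ≡ y
⟨$⟩ʳ-injective ρ {x} {y} e = begin
  x                      ≡⟨ inverseˡ ρ ⟨
  ρ ⟨$⟩ˡ (ρ ⟨$⟩ʳ x)      ≡⟨ cong (ρ ⟨$⟩ˡ_) e ⟩
  ρ ⟨$⟩ˡ (ρ ⟨$⟩ʳ y)      ≡⟨ inverseˡ ρ ⟩
  y                      ∎
  where open ≡-Reasoning

count-permute : ∀ {n} {P : Pred (Fin n) 0ℓ} (P? : Decidable P) (π : Permutation′ n) →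
                count P? (allFin n) ≡ count (P? ∘ (π ⟨$⟩ʳ_)) (allFin n)
count-permute {n} {P} P? π = ≤-antisym
  (count-≤-injection P? (P? ∘ (π ⟨$⟩ʳ_)) (Unique.allFin⁺ n) (π ⟨$⟩ˡ_) (⟨$⟩ʳ-injective (Permutation.flip π))
    λ _ px → ∈-allFin _ , subst P (sym (inverseʳ π)) px)
  (count-≤-injection (P? ∘ (π ⟨$⟩ʳ_)) P? (Unique.allFin⁺ n) (π ⟨$⟩ʳ_) (⟨$⟩ʳ-injective π)
    λ _ px → ∈-allFin _ , px)

count-filter : {P Q : Pred A 0ℓ} (P? : Decidable P) (Q? : Decidable Q) → ∀ xs →
               count Q? (filter P? xs) ≡ count (λ x → P? x ×-dec Q? x) xs
count-filter P? Q? [] = refl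
count-filter P? Q? (x ∷ xs) with P? x
... | no _ = count-filter P? Q? xs
... | yes _ with Q? x
...   | yes _ = cong suc (count-filter P? Q? xs)
...   | no _  = count-filter P? Q? xs

count-⇔ : {P Q : Pred A 0ℓ} (P? : Decidable P) (Q? : Decidable Q) → (∀ {x} → P x ⇔ Q x) → ∀ xs →
          count P? xs ≡ count Q? xs
count-⇔ P? Q? P⇔Q xs = count-cong P? Q? xs (λ _ → Equivalence.to P⇔Q) (λ _ → Equivalence.from P⇔Q)

count-true : ∀ (xs : List A) → count {P = λ _ → ⊤} (λ _ → yes tt) xs ≡ length xs
count-true []       = refl
count-true (x ∷ xs) = cong suc (count-true xs)

AllPairs-reverse : ∀ {R : A → A → Set} {xs} → AllPairs R xs → AllPairs (flip R) (reverse xs)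
AllPairs-reverse {xs = []}     []           = []
AllPairs-reverse {xs = x ∷ xs} (Rx ∷ xs↑) rewrite unfold-reverse x xs =
  AllPairs.++⁺ (AllPairs-reverse xs↑) (All.[] ∷ []) (All.tabulate (λ y∈ → All.lookup Rx (Any.reverse⁻ y∈) All.∷ All.[]))

map-injective-on : ∀ {f : A → B} {xs} → Unique (map f xs) → ∀ {x y} → x ∈ xs → y ∈ xs → f x ≡ f y → x ≡ y
map-injective-on {xs = _ ∷ _}  _          (here refl) (here refl) _ = refl
map-injective-on {xs = _ ∷ xs} (fx∉ ∷ _)  (here refl) (there y∈) e = contradiction e (All.lookup fx∉ (∈-map⁺ _ y∈))
map-injective-on {xs = _ ∷ xs} (fy∉ ∷ _)  (there x∈) (here refl) e = contradiction (sym e) (All.lookup fy∉ (∈-map⁺ _ x∈))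
map-injective-on {xs = _ ∷ xs} (_ ∷ !fxs) (there x∈) (there y∈) e = map-injective-on !fxs x∈ y∈ e

Decreasing : List ℕ → Set
Decreasing = AllPairs _>_

record Pick (e : ℕ) (cs : List ℕ) : Set where
  field
    value : ℕ
    rest : List ℕ
    pickAt≡ : pickAt e cs ≡ just (value , rest)
    cs↭ : cs ↭ value ∷ rest
    rest-decreasing : Decreasing rest
    larger-in-rest : count (value <?_) rest ≡ e

pick : ∀ e cs → Decreasing cs → e < length cs → Pick e cs
pick zero (c ∷ cs) (c>cs ∷ cs↓) _ = record
  { value = c ; rest = cs ; pickAt≡ = refl ; cs↭ = ↭-refl ; rest-decreasing = cs↓
  ; larger-in-rest = count-none (c <?_) cs λ c′∈cs c<c′ → <-asym c<c′ (All.lookup c>cs c′∈cs) }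
pick (suc e) (c ∷ cs) (c>cs ∷ cs↓) (s≤s e<len) = record
  { value = P.value
  ; rest = c ∷ P.rest
  ; pickAt≡ = pickAt≡
  ; cs↭ = ↭-trans (↭-prep c P.cs↭) (↭-swap c P.value ↭-refl)
  ; rest-decreasing = All.tabulate (All.lookup c>cs ∘ ∈-resp-↭ (↭-sym P.cs↭) ∘ there) ∷ P.rest-decreasing
  ; larger-in-rest = trans (count-accept (P.value <?_) (All.lookup c>cs (∈-resp-↭ (↭-sym P.cs↭) (here refl))))
                           (cong suc P.larger-in-rest) }
  where
  module P = Pick (pick e cs cs↓ e<len)
  pickAt≡ : pickAt (suc e) (c ∷ cs) ≡ just (P.value , c ∷ P.rest)
  pickAt≡ rewrite P.pickAt≡ = refl

-- Standardising an injective sequence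

injective⇒surjective : ∀ {M} (f : Fin M → Fin M) → (∀ {a b} → f a ≡ f b → a ≡ b) → ∀ y → ∃ λ x → f x ≡ y
injective⇒surjective {suc M} f f-inj y with any? (λ x → f x ≟ᶠ y)
... | yes hit = hit
... | no miss = contradiction (injective⇒≤ punched-injective) 1+n≰n
  where
  punched : Fin (suc M) → Fin M
  punched x = punchOut {i = y} λ y≡fx → miss (x , sym y≡fx)
  punched-injective : ∀ {a b} → punched a ≡ punched b → a ≡ b
  punched-injective = f-inj ∘′ punchOut-injective {i = y} _ _

module Standardise {M : ℕ} (g : Fin M → ℕ) (g-inj : ∀ {a b} → g a ≡ g b → a ≡ b) where

  rank : Fin M → ℕ
  rank a = count (λ b → g b <? g a) (allFin M)

  rank<M : ∀ a → rank a < M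
  rank<M a = subst (rank a <_) (length-tabulate _)
    (filter-notAll (λ b → g b <? g a) (allFin M) (Any.map (λ { refl → <-irrefl refl }) (∈-allFin a)))

  rank-mono : ∀ {a b} → g a < g b → rank a < rank b
  rank-mono {a} {b} ga<gb = count-strict (λ c → g c <? g a) (λ c → g c <? g b) (allFin M)
    (λ _ gc<ga → <-trans gc<ga ga<gb) (∈-allFin a) ga<gb (<-irrefl refl)

  rank-reflects : ∀ {a b} → rank a < rank b → g a < g b
  rank-reflects {a} {b} ra<rb with <-cmp (g a) (g b)
  ... | tri< ga<gb _ _ = ga<gb
  ... | tri≈ _ ga≡gb _ = contradiction (cong rank (g-inj ga≡gb)) (λ ra≡rb → <-irrefl ra≡rb ra<rb)
  ... | tri> _ _ gb<ga = contradiction (rank-mono gb<ga) (<-asym ra<rb)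

  rank-injective : ∀ {a b} → rank a ≡ rank b → a ≡ b
  rank-injective {a} {b} ra≡rb with <-cmp (g a) (g b)
  ... | tri< ga<gb _ _ = contradiction (rank-mono ga<gb) (λ ra<rb → <-irrefl ra≡rb ra<rb)
  ... | tri≈ _ ga≡gb _ = g-inj ga≡gb
  ... | tri> _ _ gb<ga = contradiction (rank-mono gb<ga) (λ rb<ra → <-irrefl (sym ra≡rb) rb<ra)

  rankᶠ : Fin M → Fin M
  rankᶠ a = fromℕ< (rank<M a)

  rankᶠ-injective : ∀ {a b} → rankᶠ a ≡ rankᶠ b → a ≡ b
  rankᶠ-injective e = rank-injective (trans (sym (toℕ-fromℕ< _)) (trans (cong toℕ e) (toℕ-fromℕ< _)))

  standardise : Permutation′ M
  standardise = permutation rankᶠ (proj₁ ∘ surj) (proj₂ ∘ surj) (λ a → rankᶠ-injective (proj₂ (surj (rankᶠ a))))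
    where surj = injective⇒surjective rankᶠ rankᶠ-injective

  toℕ-standardise : ∀ a → toℕ (standardise ⟨$⟩ʳ a) ≡ rank a
  toℕ-standardise a = toℕ-fromℕ< (rank<M a)

  standardise-occurrence : ∀ {n} (w : Fin n → ℕ) (f : Fin M → Fin n) → (∀ a → w (f a) ≡ g a) →
    (∀ a b → toℕ a < toℕ b → toℕ (f a) < toℕ (f b)) → Occurrence w standardise f
  standardise-occurrence w f w∘f≡g f-mono = f-mono , λ a b → mk⇔
    (λ lt → subst₂ _<_ (sym (τ a)) (sym (τ b)) (rank-mono (subst₂ _<_ (w∘f≡g a) (w∘f≡g b) lt)))
    (λ lt → subst₂ _<_ (sym (w∘f≡g a)) (sym (w∘f≡g b)) (rank-reflects (subst₂ _<_ (τ a) (τ b) lt)))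
    where τ = toℕ-standardise

  rank-maximum : ∀ {M′} → M ≡ suc M′ → ∀ {a} → (∀ c → c ≢ a → g c < g a) → rank a ≡ M′
  rank-maximum refl {a} maximal = ≤-antisym (s≤s⁻¹ (rank<M a))
    (count-≥-injection (λ c → g c <? g a) (allFin M) (punchIn a) (punchIn-injective a _ _)
      (λ _ → ∈-allFin _) (λ c → maximal (punchIn a c) (punchInᵢ≢i a c)))

penultimate ultimate : ∀ d → Fin (2 + d)
penultimate d = inject₁ (fromℕ d)
ultimate d = fromℕ (suc d)

front : ∀ {d} → Fin d → Fin (2 + d)
front = inject₁ ∘ inject₁

toℕ-front : ∀ {d} (b : Fin d) → toℕ (front b) ≡ toℕ b
toℕ-front b = trans (toℕ-inject₁ (inject₁ b)) (toℕ-inject₁ b)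

front-injective : ∀ {d} {a b : Fin d} → front a ≡ front b → a ≡ b
front-injective = inject₁-injective ∘ inject₁-injective

toℕ-front<d : ∀ {d} (b : Fin d) → toℕ (front b) < d
toℕ-front<d b = subst (_< _) (sym (toℕ-front b)) (toℕ<n b)

toℕ-penultimate : ∀ d → toℕ (penultimate d) ≡ d
toℕ-penultimate d = trans (toℕ-inject₁ (fromℕ d)) (toℕ-fromℕ d)

toℕ-ultimate : ∀ d → toℕ (ultimate d) ≡ suc d
toℕ-ultimate d = toℕ-fromℕ (suc d)

data Slot (d : ℕ) : Fin (2 + d) → Set where
  at-front       : (b : Fin d) → Slot d (front b)
  at-penultimate : Slot d (penultimate d)
  at-ultimate    : Slot d (ultimate d)

slot-suc : ∀ {d a} → Slot d a → Slot (suc d) (suc a)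
slot-suc (at-front b)   = at-front (suc b)
slot-suc at-penultimate = at-penultimate
slot-suc at-ultimate    = at-ultimate

slot : ∀ {d} (a : Fin (2 + d)) → Slot d a
slot {zero}  zero       = at-penultimate
slot {zero}  (suc zero) = at-ultimate
slot {suc d} zero       = at-front zero
slot {suc d} (suc a)    = slot-suc (slot a)

slot-front : ∀ {d} (b : Fin d) → slot (front b) ≡ at-front b
slot-front {suc d} zero    = refl
slot-front {suc d} (suc b) = cong slot-suc (slot-front b)

slot-penultimate : ∀ d → slot (penultimate d) ≡ at-penultimate
slot-penultimate zero    = refl
slot-penultimate (suc d) = cong slot-suc (slot-penultimate d)

slot-ultimate : ∀ d → slot (ultimate d) ≡ at-ultimate
slot-ultimate zero    = refl
slot-ultimate (suc d) = cong slot-suc (slot-ultimate d)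

front-or-last-two : ∀ {d} (c : Fin (2 + d)) → c ≢ penultimate d → c ≢ ultimate d → toℕ c < d
front-or-last-two c c≢p c≢u with slot c
... | at-front b     = toℕ-front<d b
... | at-penultimate = contradiction refl c≢p
... | at-ultimate    = contradiction refl c≢u

-- Defs locates the last two positions of a pattern of length m 1-indexed and additively.
is-penultimate : ∀ {d} {a : Fin (2 + d)} → suc (toℕ a) + 1 ≡ 2 + d ⇔ a ≡ penultimate d
is-penultimate {d} {a} = mk⇔
  (λ e → toℕ-injective (trans (suc-injective (suc-injective (trans (+-comm 1 (suc (toℕ a))) e))) (sym (toℕ-penultimate d))))
  (λ { refl → trans (cong (λ x → suc x + 1) (toℕ-penultimate d)) (+-comm (suc d) 1) })

is-ultimate : ∀ {d} {a : Fin (2 + d)} → suc (toℕ a) ≡ 2 + d ⇔ a ≡ ultimate d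
is-ultimate {d} {a} = mk⇔
  (λ e → toℕ-injective (trans (suc-injective e) (sym (toℕ-ultimate d))))
  (λ { refl → cong suc (toℕ-ultimate d) })

module _ {d : ℕ} (X : Fin (2 + d) → Set) where

  at-penultimate-⇔ : (∀ a → suc (toℕ a) + 1 ≡ 2 + d → X a) ⇔ X (penultimate d)
  at-penultimate-⇔ = mk⇔ (λ h → h _ (Equivalence.from is-penultimate refl))
                         (λ x a e → subst X (sym (Equivalence.to is-penultimate e)) x)

  at-ultimate-⇔ : (∀ a → suc (toℕ a) ≡ 2 + d → X a) ⇔ X (ultimate d)
  at-ultimate-⇔ = mk⇔ (λ h → h _ (Equivalence.from is-ultimate refl))
                      (λ x a e → subst X (sym (Equivalence.to is-ultimate e)) x)

FinalTwo-⇔ : ∀ {d n} {f : Fin (2 + d) → Fin n} {i j} → FinalTwo f i j ⇔ (f (penultimate d) ≡ i × f (ultimate d) ≡ j)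
FinalTwo-⇔ {f = f} {i} {j} = at-penultimate-⇔ (λ a → f a ≡ i) ×-⇔ at-ultimate-⇔ (λ a → f a ≡ j)

InA-⇔ : ∀ {d} {τ : Permutation′ (2 + d)} →
        InA (2 + d) τ ⇔ (τ ⟨$⟩ʳ penultimate d ≡ ultimate d × τ ⟨$⟩ʳ ultimate d ≡ penultimate d)
InA-⇔ {τ = τ} =
  ⇔-trans (at-penultimate-⇔ (λ a → suc (toℕ (τ ⟨$⟩ʳ a)) ≡ _)) is-ultimate
  ×-⇔ ⇔-trans (at-ultimate-⇔ (λ a → suc (toℕ (τ ⟨$⟩ʳ a)) + 1 ≡ _)) is-penultimate

InB-⇔ : ∀ {d} {τ : Permutation′ (2 + d)} →
        InB (2 + d) τ ⇔ (τ ⟨$⟩ʳ penultimate d ≡ penultimate d × τ ⟨$⟩ʳ ultimate d ≡ ultimate d)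
InB-⇔ {τ = τ} =
  ⇔-trans (at-penultimate-⇔ (λ a → suc (toℕ (τ ⟨$⟩ʳ a)) + 1 ≡ _)) is-penultimate
  ×-⇔ ⇔-trans (at-ultimate-⇔ (λ a → suc (toℕ (τ ⟨$⟩ʳ a)) ≡ _)) is-ultimate

d≤penultimate : ∀ d → d ≤ toℕ (penultimate d)
d≤penultimate d = ≤-reflexive (sym (toℕ-penultimate d))

d≤ultimate : ∀ d → d ≤ toℕ (ultimate d)
d≤ultimate d = ≤-trans (n≤1+n d) (≤-reflexive (sym (toℕ-ultimate d)))

front<penultimate : ∀ {d} (b : Fin d) → toℕ (front b) < toℕ (penultimate d)
front<penultimate {d} b = <-≤-trans (toℕ-front<d b) (d≤penultimate d)

ultimate-maximal : ∀ {d} (b : Fin (2 + d)) → ¬ toℕ (ultimate d) < toℕ b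
ultimate-maximal {d} b = ≤⇒≯ (subst (toℕ b ≤_) (sym (toℕ-ultimate d)) (s≤s⁻¹ (toℕ<n b)))

-- A-pairs and B-pairs

lowerBefore : ∀ {n} → (Fin n → ℕ) → ℕ → ℕ → ℕ
lowerBefore {n} w b x = count (λ k → toℕ k <? b ×-dec w k <? x) (allFin n)

HighInversion HighAscent : ℕ → ∀ {n} → (Fin n → ℕ) → Fin n → Fin n → Set
HighInversion d w i j = toℕ i < toℕ j × w j < w i × d ≤ lowerBefore w (toℕ i) (w j)
HighAscent    d w i j = toℕ i < toℕ j × w i < w j × d ≤ lowerBefore w (toℕ i) (w i)

highInversion? : ∀ d {n} (w : Fin n → ℕ) i → Decidable (HighInversion d w i)
highInversion? d w i j = toℕ i <? toℕ j ×-dec w j <? w i ×-dec d ≤? lowerBefore w (toℕ i) (w j)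

highAscent? : ∀ d {n} (w : Fin n → ℕ) i → Decidable (HighAscent d w i)
highAscent? d w i j = toℕ i <? toℕ j ×-dec w i <? w j ×-dec d ≤? lowerBefore w (toℕ i) (w i)

increasing⇒injective : ∀ {k n} {f : Fin k → Fin n} → (∀ a b → toℕ a < toℕ b → toℕ (f a) < toℕ (f b)) →
                       ∀ {a b} → f a ≡ f b → a ≡ b
increasing⇒injective {f = f} f-inc {a} {b} fa≡fb with <-cmp (toℕ a) (toℕ b)
... | tri< a<b _ _ = contradiction (f-inc a b a<b) (<-irrefl (cong toℕ fa≡fb))
... | tri≈ _ a≡b _ = toℕ-injective a≡b
... | tri> _ _ b<a = contradiction (f-inc b a b<a) (<-irrefl (cong toℕ (sym fa≡fb)))

lookup-increasing : ∀ {A : Set} {R : A → A → Set} {xs : List A} → AllPairs R xs →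
                    ∀ {a b} → toℕ a < toℕ b → R (lookup xs a) (lookup xs b)
lookup-increasing {xs = x ∷ xs} (x<xs ∷ _)  {zero}  {suc b} _         = All.lookup x<xs (∈-lookup b)
lookup-increasing {xs = x ∷ xs} (_ ∷ xs↑)  {suc a} {suc b} (s≤s a<b) = lookup-increasing xs↑ a<b

module _ {n} (w : Fin n → ℕ) (d : ℕ) where

  module _ (τ : Permutation′ (2 + d)) (f : Fin (2 + d) → Fin n) (occ : Occurrence w τ f) where

    front-values : ∀ {p q} → d ≤ toℕ p → d ≤ toℕ q → τ ⟨$⟩ʳ p ≡ penultimate d → τ ⟨$⟩ʳ q ≡ ultimate d →
                   ∀ a → toℕ a < d → toℕ (τ ⟨$⟩ʳ a) < d
    front-values d≤p d≤q τp τq a a<d = front-or-last-two (τ ⟨$⟩ʳ a)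
      (λ τa≡ → ≤⇒≯ d≤p (subst (λ c → toℕ c < d) (⟨$⟩ʳ-injective τ (trans τa≡ (sym τp))) a<d))
      (λ τa≡ → ≤⇒≯ d≤q (subst (λ c → toℕ c < d) (⟨$⟩ʳ-injective τ (trans τa≡ (sym τq))) a<d))

    lowerBefore-occurrence : (∀ a → toℕ a < d → toℕ (τ ⟨$⟩ʳ a) < d) →
                             ∀ p → d ≤ toℕ (τ ⟨$⟩ʳ p) → d ≤ lowerBefore w (toℕ (f (penultimate d))) (w (f p))
    lowerBefore-occurrence front-low p d≤τp =
      count-≥-injection _ (allFin n) (f ∘ front)
        (front-injective ∘ increasing⇒injective (proj₁ occ))
        (λ _ → ∈-allFin _) (λ b → before b , below b)
      where
      before : ∀ b → toℕ (f (front b)) < toℕ (f (penultimate d))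
      before b = proj₁ occ _ _ (<-≤-trans (toℕ-front<d b) (d≤penultimate d))
      below : ∀ b → w (f (front b)) < w (f p)
      below b = Equivalence.from (proj₂ occ _ _) (<-≤-trans (front-low _ (toℕ-front<d b)) d≤τp)

  APair⇒HighInversion : ∀ {i j} → APair (2 + d) w (i , j) → HighInversion d w i j
  APair⇒HighInversion {i} {j} (i<j , τ , inA , f , occ , final) =
    i<j , subst₂ (λ x y → w x < w y) fu≡j fp≡i wfu<wfp ,
    subst₂ (λ x y → d ≤ lowerBefore w (toℕ x) (w y)) fp≡i fu≡j
      (lowerBefore-occurrence τ f occ front-low (ultimate d) (subst (d ≤_) (sym τu) ≤-refl))
    where
    open Equivalence
    τp≡u = proj₁ (to (InA-⇔ {τ = τ}) inA)
    τu≡p = proj₂ (to (InA-⇔ {τ = τ}) inA)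
    fp≡i = proj₁ (to (FinalTwo-⇔ {f = f}) final)
    fu≡j = proj₂ (to (FinalTwo-⇔ {f = f}) final)
    τu : toℕ (τ ⟨$⟩ʳ ultimate d) ≡ d
    τu = trans (cong toℕ τu≡p) (toℕ-penultimate d)
    τp : toℕ (τ ⟨$⟩ʳ penultimate d) ≡ suc d
    τp = trans (cong toℕ τp≡u) (toℕ-ultimate d)
    front-low = front-values τ f occ (d≤ultimate d) (d≤penultimate d) τu≡p τp≡u
    wfu<wfp : w (f (ultimate d)) < w (f (penultimate d))
    wfu<wfp = from (proj₂ occ _ _) (subst₂ _<_ (sym τu) (sym τp) (n<1+n d))

  BPair⇒HighAscent : ∀ {i j} → BPair (2 + d) w (i , j) → HighAscent d w i j
  BPair⇒HighAscent {i} {j} (i<j , τ , inB , f , occ , final) =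
    i<j , subst₂ (λ x y → w x < w y) fp≡i fu≡j wfp<wfu ,
    subst (λ x → d ≤ lowerBefore w (toℕ x) (w x)) fp≡i
      (lowerBefore-occurrence τ f occ front-low (penultimate d) (subst (d ≤_) (sym τp) ≤-refl))
    where
    open Equivalence
    τp≡p = proj₁ (to (InB-⇔ {τ = τ}) inB)
    τu≡u = proj₂ (to (InB-⇔ {τ = τ}) inB)
    fp≡i = proj₁ (to (FinalTwo-⇔ {f = f}) final)
    fu≡j = proj₂ (to (FinalTwo-⇔ {f = f}) final)
    τp : toℕ (τ ⟨$⟩ʳ penultimate d) ≡ d
    τp = trans (cong toℕ τp≡p) (toℕ-penultimate d)
    τu : toℕ (τ ⟨$⟩ʳ ultimate d) ≡ suc d
    τu = trans (cong toℕ τu≡u) (toℕ-ultimate d)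
    front-low = front-values τ f occ (d≤penultimate d) (d≤ultimate d) τp≡p τu≡u
    wfp<wfu : w (f (penultimate d)) < w (f (ultimate d))
    wfp<wfu = from (proj₂ occ _ _) (subst₂ _<_ (sym τp) (sym τu) (n<1+n d))

  module Embedding (w-inj : ∀ {a b} → w a ≡ w b → a ≡ b) {i j : Fin n} (i<j : toℕ i < toℕ j)
                   (u : ℕ) (u≤wi : u ≤ w i) (u≤wj : u ≤ w j) (enough : d ≤ lowerBefore w (toℕ i) u) where

    Below : Fin n → Set
    Below k = toℕ k < toℕ i × w k < u

    below? : ∀ k → Dec (Below k)
    below? k = toℕ k <? toℕ i ×-dec w k <? u

    ks : List (Fin n)
    ks = filter below? (allFin n)

    ks-increasing : AllPairs (λ a b → toℕ a < toℕ b) ks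
    ks-increasing = AllPairs.filter⁺ below? (AllPairs.tabulate⁺-< (λ a<b → a<b))

    place : ∀ {a} → Slot d a → Fin n
    place (at-front b)   = lookup ks (inject≤ b enough)
    place at-penultimate = i
    place at-ultimate    = j

    f : Fin (2 + d) → Fin n
    f a = place (slot a)

    place-front : ∀ b → Below (place (at-front b))
    place-front b = proj₂ (∈-filter⁻ below? {xs = allFin n} (∈-lookup (inject≤ b enough)))

    f-front : ∀ b → Below (f (front b))
    f-front b = subst (Below ∘ place) (sym (slot-front b)) (place-front b)

    f-penultimate : f (penultimate d) ≡ i
    f-penultimate = cong place (slot-penultimate d)

    f-ultimate : f (ultimate d) ≡ j
    f-ultimate = cong place (slot-ultimate d)

    f-increasing : ∀ a b → toℕ a < toℕ b → toℕ (f a) < toℕ (f b)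
    f-increasing a b a<b with slot a | slot b
    ... | at-front x     | at-front y     = lookup-increasing ks-increasing
      (subst₂ _<_ (sym (toℕ-inject≤ x _)) (sym (toℕ-inject≤ y _)) (subst₂ _<_ (toℕ-front x) (toℕ-front y) a<b))
    ... | at-front x     | at-penultimate = proj₁ (place-front x)
    ... | at-front x     | at-ultimate    = <-trans (proj₁ (place-front x)) i<j
    ... | at-penultimate | at-ultimate    = i<j
    ... | at-penultimate | at-front y     = contradiction (front<penultimate y) (<-asym a<b)
    ... | at-penultimate | at-penultimate = contradiction a<b (<-irrefl refl)
    ... | at-ultimate    | _              = contradiction a<b (ultimate-maximal b)

    g : Fin (2 + d) → ℕ
    g = w ∘ f

    open Standardise g (increasing⇒injective f-increasing ∘ w-inj) hiding (standardise)
    open Standardise g (increasing⇒injective f-increasing ∘ w-inj) public using (standardise)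

    occurrence : Occurrence w standardise f
    occurrence = standardise-occurrence w f (λ _ → refl) f-increasing

    final-two : FinalTwo f i j
    final-two = Equivalence.from FinalTwo-⇔ (f-penultimate , f-ultimate)

    top-two : ∀ {p q} → (∀ c → c ≢ p → g c < g p) → u ≤ g q → g q < g p →
              standardise ⟨$⟩ʳ p ≡ ultimate d × standardise ⟨$⟩ʳ q ≡ penultimate d
    top-two {p} {q} maximal u≤gq gq<gp =
      standardise-at (trans rank-p (sym (toℕ-ultimate d))) , standardise-at (trans rank-q (sym (toℕ-penultimate d)))
      where
      standardise-at : ∀ {a c} → rank a ≡ toℕ c → standardise ⟨$⟩ʳ a ≡ c
      standardise-at {a} rank≡ = toℕ-injective (trans (toℕ-standardise a) rank≡)
      rank-p : rank p ≡ suc d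
      rank-p = rank-maximum refl maximal
      rank-q : rank q ≡ d
      rank-q = ≤-antisym (s≤s⁻¹ (subst (rank q <_) rank-p (rank-mono gq<gp)))
        (count-≥-injection (λ c → g c <? g q) (allFin (2 + d)) front front-injective (λ _ → ∈-allFin _)
          (λ b → <-≤-trans (proj₂ (f-front b)) u≤gq))

    inversion-pattern : w j < w i → InA (2 + d) standardise
    inversion-pattern wj<wi = Equivalence.from (InA-⇔ {τ = standardise})
      (top-two (λ c c≢p → subst (λ x → g c < w x) (sym f-penultimate) (below-i c c≢p))
               (subst (λ x → u ≤ w x) (sym f-ultimate) u≤wj)
               (subst₂ (λ x y → w x < w y) (sym f-ultimate) (sym f-penultimate) wj<wi))
      where
      below-i : ∀ c → c ≢ penultimate d → g c < w i
      below-i c c≢p with slot c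
      ... | at-front b     = <-≤-trans (proj₂ (place-front b)) u≤wi
      ... | at-penultimate = contradiction refl c≢p
      ... | at-ultimate    = wj<wi

    ascent-pattern : w i < w j → InB (2 + d) standardise
    ascent-pattern wi<wj = Equivalence.from (InB-⇔ {τ = standardise}) (swap
      (top-two (λ c c≢u → subst (λ x → g c < w x) (sym f-ultimate) (below-j c c≢u))
               (subst (λ x → u ≤ w x) (sym f-penultimate) u≤wi)
               (subst₂ (λ x y → w x < w y) (sym f-penultimate) (sym f-ultimate) wi<wj)))
      where
      below-j : ∀ c → c ≢ ultimate d → g c < w j
      below-j c c≢u with slot c
      ... | at-front b     = <-≤-trans (proj₂ (place-front b)) u≤wj
      ... | at-penultimate = wi<wj
      ... | at-ultimate    = contradiction refl c≢u

  module _ (w-inj : ∀ {a b} → w a ≡ w b → a ≡ b) {i j : Fin n} where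

    HighInversion⇒APair : HighInversion d w i j → APair (2 + d) w (i , j)
    HighInversion⇒APair (i<j , wj<wi , enough) =
      i<j , standardise , inversion-pattern wj<wi , f , occurrence , final-two
      where open Embedding w-inj i<j (w j) (<⇒≤ wj<wi) ≤-refl enough

    HighAscent⇒BPair : HighAscent d w i j → BPair (2 + d) w (i , j)
    HighAscent⇒BPair (i<j , wi<wj , enough) =
      i<j , standardise , ascent-pattern wi<wj , f , occurrence , final-two
      where open Embedding w-inj i<j (w i) ≤-refl (<⇒≤ wi<wj) enough

    APair-⇔ : APair (2 + d) w (i , j) ⇔ HighInversion d w i j
    APair-⇔ = mk⇔ APair⇒HighInversion HighInversion⇒APair

    BPair-⇔ : BPair (2 + d) w (i , j) ⇔ HighAscent d w i j
    BPair-⇔ = mk⇔ BPair⇒HighAscent HighAscent⇒BPair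

-- Counting pairs row by row

module _ {n : ℕ} {R : Fin n → Fin n → Set} (R? : ∀ i → Decidable (R i)) where

  row : Fin n → List (Fin n × Fin n)
  row i = map (i ,_) (filter (R? i) (allFin n))

  pairsWhere : List (Fin n) → List (Fin n × Fin n)
  pairsWhere []       = []
  pairsWhere (i ∷ is) = row i ++ pairsWhere is

  ∈-pairsWhere⁻ : ∀ is {i j} → (i , j) ∈ pairsWhere is → i ∈ is × R i j
  ∈-pairsWhere⁻ (i′ ∷ is) p∈ with ∈-++⁻ (row i′) p∈
  ... | inj₂ p∈rest = let i∈ , rij = ∈-pairsWhere⁻ is p∈rest in there i∈ , rij
  ... | inj₁ p∈row with ∈-map⁻ (i′ ,_) p∈row
  ...   | j , j∈ , refl = here refl , proj₂ (∈-filter⁻ (R? i′) {xs = allFin n} j∈)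

  ∈-pairsWhere⁺ : ∀ is {i j} → i ∈ is → R i j → (i , j) ∈ pairsWhere is
  ∈-pairsWhere⁺ (i ∷ is) (here refl) rij = ∈-++⁺ˡ (∈-map⁺ (i ,_) (∈-filter⁺ (R? i) (∈-allFin _) rij))
  ∈-pairsWhere⁺ (i′ ∷ is) (there i∈) rij = ∈-++⁺ʳ (row i′) (∈-pairsWhere⁺ is i∈ rij)

  pairsWhere-unique : ∀ {is} → Unique is → Unique (pairsWhere is)
  pairsWhere-unique {[]}     []           = []
  pairsWhere-unique {i ∷ is} (i∉is ∷ !is) =
    Unique.++⁺ (Unique.map⁺ (cong proj₂) (Unique.filter⁺ (R? i) (Unique.allFin⁺ n))) (pairsWhere-unique !is) disjoint
    where
    disjoint : ∀ {p} → ¬ (p ∈ row i × p ∈ pairsWhere is)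
    disjoint (p∈row , p∈rest) with ∈-map⁻ (i ,_) p∈row
    ... | _ , _ , refl = All.lookup i∉is (proj₁ (∈-pairsWhere⁻ is p∈rest)) refl

  length-pairsWhere : ∀ is → length (pairsWhere is) ≡ sum (map (λ i → count (R? i) (allFin n)) is)
  length-pairsWhere []       = refl
  length-pairsWhere (i ∷ is) = begin
    length (row i ++ pairsWhere is)               ≡⟨ length-++ (row i) ⟩
    length (row i) + length (pairsWhere is)       ≡⟨ cong₂ _+_ (length-map (i ,_) (filter (R? i) (allFin n)))
                                                               (length-pairsWhere is) ⟩
    count (R? i) (allFin n) + sum (map _ is)      ∎
    where open ≡-Reasoning

  HasCount-rows : {P : Fin n × Fin n → Set} → (∀ {i j} → P (i , j) ⇔ R i j) →
                  {r : Fin n → ℕ} → (∀ i → count (R? i) (allFin n) ≡ r i) → HasCount P (sum (map r (allFin n)))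
  HasCount-rows P⇔R rows =
    pairsWhere (allFin n) , pairsWhere-unique (Unique.allFin⁺ n) ,
    (λ { (i , j) → mk⇔ (Equivalence.from P⇔R ∘ proj₂ ∘ ∈-pairsWhere⁻ (allFin n))
                       (∈-pairsWhere⁺ (allFin n) (∈-allFin i) ∘ Equivalence.to P⇔R) }) ,
    trans (length-pairsWhere (allFin n)) (cong sum (map-cong rows (allFin n)))

-- The map Φ

T-<ᵇ : ∀ {m n} → T (m <ᵇ n) ⇔ m < n
T-<ᵇ {m} {n} = mk⇔ (<ᵇ⇒< m n) <⇒<ᵇ

T-≤ᵇ : ∀ {m n} → T (m ≤ᵇ n) ⇔ m ≤ n
T-≤ᵇ {m} {n} = mk⇔ (≤ᵇ⇒≤ m n) ≤⇒≤ᵇ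

T-≡ᵇ : ∀ {m n} → T (m ≡ᵇ n) ⇔ m ≡ n
T-≡ᵇ {m} {n} = mk⇔ (≡ᵇ⇒≡ m n) (≡⇒≡ᵇ m n)

T-not : ∀ {b} → T (not b) ⇔ (¬ T b)
T-not {true}  = mk⇔ (λ ()) (λ ¬t → ¬t _)
T-not {false} = mk⇔ (λ _ ()) _

+2-≤-⇔ : ∀ {d x} → 2 + d ≤ x + 2 ⇔ d ≤ x
+2-≤-⇔ {d} {x} = mk⇔ (λ le → s≤s⁻¹ (s≤s⁻¹ (subst (2 + d ≤_) (+-comm x 2) le)))
                     (λ le → subst (2 + d ≤_) (+-comm 2 x) (s≤s (s≤s le)))

+3-≤-⇔ : ∀ {d x} → x + 3 ≤ 2 + d ⇔ x < d
+3-≤-⇔ {d} {x} = mk⇔ (λ le → s≤s⁻¹ (s≤s⁻¹ (subst (_≤ 2 + d) (+-comm x 3) le)))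
                     (λ lt → subst (_≤ 2 + d) (+-comm 3 x) (s≤s (s≤s lt)))

lookupAssoc-here : ∀ {n} (i : Fin n) v rest → lookupAssoc i ((i , v) ∷ rest) ≡ v
lookupAssoc-here i v rest with toℕ i ≡ᵇ toℕ i | ≡⇒≡ᵇ (toℕ i) (toℕ i) refl
... | true | _ = refl

lookupAssoc-there : ∀ {n} {r i : Fin n} {v} → toℕ r ≢ toℕ i → ∀ rest → lookupAssoc i ((r , v) ∷ rest) ≡ lookupAssoc i rest
lookupAssoc-there {r = r} {i} r≢i rest with toℕ r ≡ᵇ toℕ i | ≡ᵇ⇒≡ (toℕ r) (toℕ i)
... | true  | r≡i = contradiction (r≡i _) r≢i
... | false | _   = refl

module Analysis (d : ℕ) {n : ℕ} (π : Permutation′ n) where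
  open PhiDef (2 + d) π hiding (Φ)

  w : Fin n → ℕ
  w = seq π

  w-injective : ∀ {a b} → w a ≡ w b → a ≡ b
  w-injective = ⟨$⟩ʳ-injective π ∘ toℕ-injective

  L : ℕ → ℕ → ℕ
  L = lowerBefore w

  L-mono-bound : ∀ {b b′} x → b ≤ b′ → L b x ≤ L b′ x
  L-mono-bound x b≤b′ = count-mono _ _ (allFin n) (λ _ (k<b , wk<x) → <-≤-trans k<b b≤b′ , wk<x)

  L-mono-value : ∀ b {x y} → x ≤ y → L b x ≤ L b y
  L-mono-value b x≤y = count-mono _ _ (allFin n) (λ _ (k<b , wk<x) → k<b , <-≤-trans wk<x x≤y)

  separates : ∀ {b x y} → L b x < d → d ≤ L b y → x < y
  separates {b} Lx<d d≤Ly = ≰⇒> λ y≤x → <⇒≱ Lx<d (≤-trans d≤Ly (L-mono-value b y≤x))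

  lowBefore≡L : ∀ i v → lowBefore i v ≡ L (toℕ i) v
  lowBefore≡L i v = count-⇔ _ _ (⇔-trans T-∧ (T-<ᵇ ×-⇔ T-<ᵇ)) (allFin n)

  Kept NonKept : Fin n → Set
  Kept i    = L (toℕ i) (w i) < d
  NonKept i = d ≤ L (toℕ i) (w i)

  kept-⇔ : ∀ {i} → T (kept i) ⇔ Kept i
  kept-⇔ {i} = ⇔-trans T-≤ᵇ (subst (λ x → x + 3 ≤ 2 + d ⇔ Kept i) (sym (lowBefore≡L i (w i))) +3-≤-⇔)

  nonKept-⇔ : ∀ {i} → T (not (kept i)) ⇔ NonKept i
  nonKept-⇔ {i} = ⇔-trans T-not (mk⇔ (λ ¬k → ≮⇒≥ (¬k ∘ Equivalence.from kept-⇔))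
                                     (λ nk k → <⇒≱ (Equivalence.to kept-⇔ k) nk))

  e≡inversions : ∀ r → e r ≡ count (highInversion? d w r) (allFin n)
  e≡inversions r = begin
    e r                                              ≡⟨ count-permute _ π ⟩
    count (T? ∘ highSquare r ∘ (π ⟨$⟩ʳ_)) (allFin n) ≡⟨ count-⇔ _ _ square-⇔ (allFin n) ⟩
    count (highInversion? d w r) (allFin n)          ∎
    where
    open ≡-Reasoning
    highSquare : Fin n → Fin n → Bool
    highSquare r j = isSquare r j ∧ (2 + d ≤ᵇ rank r j + 2)
    square-⇔ : ∀ {j} → T (highSquare r (π ⟨$⟩ʳ j)) ⇔ HighInversion d w r j
    square-⇔ {j} = mk⇔
      (λ t → let square , high = to T-∧ t ; below , after = to T-∧ square in
        subst (toℕ r <_) (cong toℕ (inverseˡ π)) (<ᵇ⇒< _ _ after) , <ᵇ⇒< _ _ below ,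
        subst (d ≤_) (lowBefore≡L r (w j)) (to +2-≤-⇔ (≤ᵇ⇒≤ _ _ high)))
      (λ (r<j , wj<wr , enough) → from T-∧
        ( from T-∧ (<⇒<ᵇ wj<wr , <⇒<ᵇ (subst (toℕ r <_) (cong toℕ (sym (inverseˡ π))) r<j))
        , ≤⇒≤ᵇ (from +2-≤-⇔ (subst (d ≤_) (sym (lowBefore≡L r (w j))) enough))))
      where open Equivalence

  inversion⇒NonKept : ∀ {r j} → HighInversion d w r j → NonKept j
  inversion⇒NonKept (r<j , _ , enough) = ≤-trans enough (L-mono-bound _ (<⇒≤ r<j))

  ∈-nonKept : ∀ {j} → j ∈ nonKept ⇔ NonKept j
  ∈-nonKept = mk⇔ (Equivalence.to nonKept-⇔ ∘ proj₂ ∘ ∈-filter⁻ (T? ∘ (not ∘ kept)) {xs = allFin n})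
                  (∈-filter⁺ (T? ∘ (not ∘ kept)) (∈-allFin _) ∘ Equivalence.from nonKept-⇔)

  largerLater? : (s : Fin n → ℕ) (j : Fin n) → Decidable (λ k → toℕ j < toℕ k × s j < s k)
  largerLater? s j k = toℕ j <? toℕ k ×-dec s j <? s k

  σ′ : List (Fin n) → List ℕ → Fin n → ℕ
  σ′ rs cs j = lookupAssoc j (assign rs cs)

  assign-∷ : ∀ {r rs cs v cs′} → pickAt (e r) cs ≡ just (v , cs′) → assign (r ∷ rs) cs ≡ (r , v) ∷ assign rs cs′
  assign-∷ {r} {rs} {cs} picked with pickAt (e r) cs | picked
  ... | _ | refl = refl

  record Invariant (b : ℕ) (rs : List (Fin n)) (cs : List ℕ) : Set where
    field
      sound         : ∀ {j} → j ∈ rs → NonKept j × b ≤ toℕ j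
      complete      : ∀ {j} → NonKept j → b ≤ toℕ j → j ∈ rs
      rs-increasing : AllPairs (λ a c → toℕ a < toℕ c) rs
      cs-decreasing : Decreasing cs
      same-length   : length cs ≡ length rs
      same-above    : ∀ x → L b x < d → count (x <?_) cs ≡ count (λ j → x <? w j) rs

  record Outcome (rs : List (Fin n)) (cs : List ℕ) : Set where
    field
      values       : map (σ′ rs cs) rs ↭ cs
      value-high   : ∀ {r} → r ∈ rs → d ≤ L (toℕ r) (σ′ rs cs r)
      larger-later : ∀ {r} → r ∈ rs → count (largerLater? (σ′ rs cs) r) rs ≡ e r

  module GreedyStep {b r rs cs} (inv : Invariant b (r ∷ rs) cs) where
    private module I = Invariant inv

    nonKept-r : NonKept r
    nonKept-r = proj₁ (I.sound (here refl))

    b≤r : b ≤ toℕ r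
    b≤r = proj₂ (I.sound (here refl))

    r<rs : ∀ {j} → j ∈ rs → toℕ r < toℕ j
    r<rs = All.lookup (AllPairs.head I.rs-increasing)

    inversions-in-rs : ∀ {j} → HighInversion d w r j → j ∈ rs
    inversions-in-rs inv@(r<j , _) with I.complete (inversion⇒NonKept inv) (≤-trans b≤r (<⇒≤ r<j))
    ... | here refl  = contradiction r<j (<-irrefl refl)
    ... | there j∈rs = j∈rs

    e≤ : ∀ {Q : Fin n → Set} (Q? : Decidable Q) → (∀ {j} → HighInversion d w r j → Q j) → e r ≤ count Q? rs
    e≤ Q? inversion⇒Q = subst (_≤ _) (sym (e≡inversions r))
      (count-≤-injection (highInversion? d w r) Q? (Unique.allFin⁺ n) id id
        (λ _ inv → inversions-in-rs inv , inversion⇒Q inv))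

    e<length : e r < length cs
    e<length = subst (e r <_) (sym I.same-length) (s≤s (≤-trans (e≤ (highInversion? d w r) id) (length-filter _ rs)))

    open Pick (pick (e r) cs I.cs-decreasing e<length) public renaming (value to v; rest to cs′)

    count-cs : ∀ x → count (x <?_) cs ≡ count (x <?_) (v ∷ cs′)
    count-cs x = count-↭ (x <?_) cs↭

    -- Otherwise v would lie below w r and below all e r inversions of row r, but only e r values left exceed v.
    v-high : d ≤ L (toℕ r) v
    v-high = ≮⇒≥ λ low → <-irrefl refl (begin
      suc (e r)                            ≤⟨ s≤s (e≤ (λ j → v <? w j) (λ (_ , _ , enough) → separates low enough)) ⟩
      suc (count (λ j → v <? w j) rs)      ≡⟨ count-accept (λ j → v <? w j) (separates low nonKept-r) ⟨
      count (λ j → v <? w j) (r ∷ rs)      ≡⟨ I.same-above v (≤-<-trans (L-mono-bound v b≤r) low) ⟨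
      count (v <?_) cs                     ≡⟨ count-cs v ⟩
      count (v <?_) (v ∷ cs′)              ≡⟨ count-reject (v <?_) (<-irrefl refl) ⟩
      count (v <?_) cs′                    ≡⟨ larger-in-rest ⟩
      e r                                  ∎)
      where open ≤-Reasoning

    same-above′ : ∀ x → L (suc (toℕ r)) x < d → count (x <?_) cs′ ≡ count (λ j → x <? w j) rs
    same-above′ x low′ = suc-injective (begin
      suc (count (x <?_) cs′)          ≡⟨ count-accept (x <?_) (separates low v-high) ⟨
      count (x <?_) (v ∷ cs′)          ≡⟨ count-cs x ⟨
      count (x <?_) cs                 ≡⟨ I.same-above x (≤-<-trans (L-mono-bound x b≤r) low) ⟩
      count (λ j → x <? w j) (r ∷ rs)  ≡⟨ count-accept (λ j → x <? w j) (separates low nonKept-r) ⟩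
      suc (count (λ j → x <? w j) rs)  ∎)
      where
      open ≡-Reasoning
      low : L (toℕ r) x < d
      low = ≤-<-trans (L-mono-bound x (n≤1+n _)) low′

    invariant′ : Invariant (suc (toℕ r)) rs cs′
    invariant′ = record
      { sound         = λ j∈rs → proj₁ (I.sound (there j∈rs)) , r<rs j∈rs
      ; complete      = complete′
      ; rs-increasing = AllPairs.tail I.rs-increasing
      ; cs-decreasing = rest-decreasing
      ; same-length   = suc-injective (trans (sym (↭-length cs↭)) I.same-length)
      ; same-above    = same-above′ }
      where
      complete′ : ∀ {j} → NonKept j → suc (toℕ r) ≤ toℕ j → j ∈ rs
      complete′ nonKept-j r<j with I.complete nonKept-j (≤-trans b≤r (<⇒≤ r<j))
      ... | here refl  = contradiction r<j (<-irrefl refl)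
      ... | there j∈rs = j∈rs

    assign-step : assign (r ∷ rs) cs ≡ (r , v) ∷ assign rs cs′
    assign-step = assign-∷ {rs = rs} {cs = cs} pickAt≡

    σ′-head : σ′ (r ∷ rs) cs r ≡ v
    σ′-head = trans (cong (lookupAssoc r) assign-step) (lookupAssoc-here r v (assign rs cs′))

    σ′-tail : ∀ {j} → j ∈ rs → σ′ (r ∷ rs) cs j ≡ σ′ rs cs′ j
    σ′-tail j∈rs = trans (cong (lookupAssoc _) assign-step) (lookupAssoc-there (<⇒≢ (r<rs j∈rs)) (assign rs cs′))

    module _ (out : Outcome rs cs′) where
      private module O = Outcome out

      values′ : map (σ′ (r ∷ rs) cs) (r ∷ rs) ↭ cs
      values′ = ↭-trans (↭-reflexive (cong₂ _∷_ σ′-head (map-cong-local (All.tabulate σ′-tail))))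
                        (↭-trans (↭-prep v O.values) (↭-sym cs↭))

      value-high′ : ∀ {j} → j ∈ r ∷ rs → d ≤ L (toℕ j) (σ′ (r ∷ rs) cs j)
      value-high′ (here refl)  = subst (λ x → d ≤ L (toℕ r) x) (sym σ′-head) v-high
      value-high′ (there j∈rs) = subst (λ x → d ≤ L _ x) (sym (σ′-tail j∈rs)) (O.value-high j∈rs)

      larger-later′ : ∀ {j} → j ∈ r ∷ rs → count (largerLater? (σ′ (r ∷ rs) cs) j) (r ∷ rs) ≡ e j
      larger-later′ (here refl) = begin
        count (largerLater? σ r) (r ∷ rs)  ≡⟨ count-reject (largerLater? σ r) (λ (r<r , _) → <-irrefl refl r<r) ⟩
        count (largerLater? σ r) rs        ≡⟨ count-cong (largerLater? σ r) (λ k → v <? σ′ rs cs′ k) rs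
                                                (λ k∈ (_ , v<σk) → subst₂ _<_ σ′-head (σ′-tail k∈) v<σk)
                                                (λ k∈ v<σk → r<rs k∈ , subst₂ _<_ (sym σ′-head) (sym (σ′-tail k∈)) v<σk) ⟩
        count (λ k → v <? σ′ rs cs′ k) rs  ≡⟨ count-map (v <?_) (σ′ rs cs′) rs ⟨
        count (v <?_) (map (σ′ rs cs′) rs) ≡⟨ count-↭ (v <?_) O.values ⟩
        count (v <?_) cs′                  ≡⟨ larger-in-rest ⟩
        e r                                ∎
        where
        open ≡-Reasoning
        σ = σ′ (r ∷ rs) cs
      larger-later′ {j} (there j∈rs) = begin
        count (largerLater? σ j) (r ∷ rs)      ≡⟨ count-reject (largerLater? σ j) (λ (j<r , _) → <-asym j<r (r<rs j∈rs)) ⟩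
        count (largerLater? σ j) rs            ≡⟨ count-cong (largerLater? σ j) (largerLater? (σ′ rs cs′) j) rs
                                                    (λ k∈ (j<k , lt) → j<k , subst₂ _<_ (σ′-tail j∈rs) (σ′-tail k∈) lt)
                                                    (λ k∈ (j<k , lt) → j<k , subst₂ _<_ (sym (σ′-tail j∈rs)) (sym (σ′-tail k∈)) lt) ⟩
        count (largerLater? (σ′ rs cs′) j) rs  ≡⟨ O.larger-later j∈rs ⟩
        e j                                    ∎
        where
        open ≡-Reasoning
        σ = σ′ (r ∷ rs) cs

      extend : Outcome (r ∷ rs) cs
      extend = record { values = values′ ; value-high = value-high′ ; larger-later = larger-later′ }

  greedy : ∀ b rs cs → Invariant b rs cs → Outcome rs cs
  greedy b []       []      inv = record { values = ↭-refl ; value-high = λ () ; larger-later = λ () }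
  greedy b []       (_ ∷ _) inv = contradiction (Invariant.same-length inv) λ ()
  greedy b (r ∷ rs) cs      inv = extend (greedy (suc (toℕ r)) rs _ invariant′)
    where open GreedyStep inv

  kept? : ∀ i → Dec (Kept i)
  kept? i = L (toℕ i) (w i) <? d

  taken : Fin n → Fin n → Bool
  taken v i = kept i ∧ (seq π i ≡ᵇ toℕ v)

  free? : Fin n → Bool
  free? v = not (any (taken v) (allFin n))

  free-⇔ : ∀ {j} → T (free? (π ⟨$⟩ʳ j)) ⇔ NonKept j
  free-⇔ {j} = ⇔-trans T-not (mk⇔
    (λ ¬taken → ≮⇒≥ λ kept-j → ¬taken (to taken-⇔ (lose (∈-allFin j) (from T-∧ (from kept-⇔ kept-j , from (T-≡ᵇ {w j}) refl)))))
    (λ nonKept-j is-taken → let i , t = satisfied (from taken-⇔ is-taken) ; kept-i , wi≡wj = to T-∧ t in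
      <⇒≱ (to kept-⇔ (subst (T ∘ kept) (w-injective (to T-≡ᵇ wi≡wj)) kept-i)) nonKept-j))
    where
    open Equivalence
    taken-⇔ = any⇔ {xs = allFin n} {p = taken (π ⟨$⟩ʳ j)}

  free-count : ∀ {Z : ℕ → Set} (Z? : Decidable Z) → count Z? freeVals ≡ count (Z? ∘ w) nonKept
  free-count Z? = begin
    count Z? freeVals                                           ≡⟨ count-↭ Z? (↭-reverse (map toℕ fvs)) ⟩
    count Z? (map toℕ fvs)                                      ≡⟨ count-map Z? toℕ fvs ⟩
    count (Z? ∘ toℕ) fvs                                        ≡⟨ count-filter (T? ∘ free?) (Z? ∘ toℕ) (allFin n) ⟩
    count (λ v → T? (free? v) ×-dec Z? (toℕ v)) (allFin n)       ≡⟨ count-permute _ π ⟩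
    count (λ j → T? (free? (π ⟨$⟩ʳ j)) ×-dec Z? (w j)) (allFin n) ≡⟨ count-⇔ _ _ (⇔-trans free-⇔ (⇔-sym nonKept-⇔) ×-⇔ ⇔-refl) (allFin n) ⟩
    count (λ j → T? (not (kept j)) ×-dec Z? (w j)) (allFin n)    ≡⟨ count-filter (T? ∘ (not ∘ kept)) (Z? ∘ w) (allFin n) ⟨
    count (Z? ∘ w) nonKept                                      ∎
    where
    open ≡-Reasoning
    fvs = filterᵇ free? (allFin n)

  initial : Invariant 0 nonKept freeVals
  initial = record
    { sound         = λ j∈ → Equivalence.to ∈-nonKept j∈ , z≤n
    ; complete      = λ nonKept-j _ → Equivalence.from ∈-nonKept nonKept-j
    ; rs-increasing = AllPairs.filter⁺ (T? ∘ (not ∘ kept)) (AllPairs.tabulate⁺-< id)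
    ; cs-decreasing = AllPairs-reverse (AllPairs.map⁺ {f = toℕ} (AllPairs.filter⁺ (T? ∘ free?) (AllPairs.tabulate⁺-< {n = n} id)))
    ; same-length   = trans (sym (count-true freeVals)) (trans (free-count (λ _ → yes tt)) (count-true nonKept))
    ; same-above    = λ x _ → free-count (x <?_) }

  open Outcome (greedy 0 nonKept freeVals initial)

  σ : Fin n → ℕ
  σ = Φ (2 + d) π

  σ-kept : ∀ {i} → Kept i → σ i ≡ w i
  σ-kept {i} kept-i with kept i | Equivalence.from kept-⇔ kept-i
  ... | true | _ = refl

  σ-nonKept : ∀ {i} → NonKept i → σ i ≡ σ′ nonKept freeVals i
  σ-nonKept {i} nonKept-i with kept i | Equivalence.from nonKept-⇔ nonKept-i
  ... | false | _ = refl

  σ-high : ∀ {i} → NonKept i → d ≤ L (toℕ i) (σ i)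
  σ-high nonKept-i = subst (λ x → d ≤ L _ x) (sym (σ-nonKept nonKept-i)) (value-high (Equivalence.from ∈-nonKept nonKept-i))

  σ-free : ∀ {i} → NonKept i → σ i ∈ freeVals
  σ-free nonKept-i = subst (_∈ freeVals) (sym (σ-nonKept nonKept-i))
    (∈-resp-↭ values (∈-map⁺ _ (Equivalence.from ∈-nonKept nonKept-i)))

  kept-not-free : ∀ {i} → Kept i → w i ∉ freeVals
  kept-not-free {i} kept-i wi∈ with ∈-map⁻ toℕ (Any.reverse⁻ wi∈)
  ... | v , v∈ , wi≡v = <⇒≱ kept-i (Equivalence.to free-⇔
    (subst (T ∘ free?) (sym (toℕ-injective wi≡v)) (proj₂ (∈-filter⁻ (T? ∘ free?) {xs = allFin n} v∈))))

  σ-injective : ∀ {a b} → σ a ≡ σ b → a ≡ b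
  σ-injective {a} {b} σa≡σb with kept? a | kept? b
  ... | yes kept-a | yes kept-b = w-injective (trans (sym (σ-kept kept-a)) (trans σa≡σb (σ-kept kept-b)))
  ... | no ¬kept-a | no ¬kept-b = map-injective-on unique-σ′-values
    (Equivalence.from ∈-nonKept (≮⇒≥ ¬kept-a)) (Equivalence.from ∈-nonKept (≮⇒≥ ¬kept-b))
    (trans (sym (σ-nonKept (≮⇒≥ ¬kept-a))) (trans σa≡σb (σ-nonKept (≮⇒≥ ¬kept-b))))
    where
    unique-σ′-values : Unique (map (σ′ nonKept freeVals) nonKept)
    unique-σ′-values = Unique-resp-↭ (↭⇒↭ₛ (↭-sym values))
      (AllPairs.map (λ x>y x≡y → <-irrefl (sym x≡y) x>y) (Invariant.cs-decreasing initial))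
  ... | yes kept-a | no ¬kept-b =
    contradiction (subst (_∈ freeVals) (trans (sym σa≡σb) (σ-kept kept-a)) (σ-free (≮⇒≥ ¬kept-b))) (kept-not-free kept-a)
  ... | no ¬kept-a | yes kept-b =
    contradiction (subst (_∈ freeVals) (trans σa≡σb (σ-kept kept-b)) (σ-free (≮⇒≥ ¬kept-a))) (kept-not-free kept-b)

  keptBelow : ℕ → ℕ → ℕ
  keptBelow b x = count (λ k → toℕ k <? b ×-dec kept? k ×-dec w k <? x) (allFin n)

  -- a non-kept entry below x before b has at least d smaller entries before it; recurse on it
  kept-suffice : ∀ b x → d ≤ L b x → d ≤ keptBelow b x
  kept-suffice = <-rec _ λ b rec x enough → helper b rec x enough
    where
    helper : ∀ b → (∀ {l} → l < b → ∀ x → d ≤ L l x → d ≤ keptBelow l x) → ∀ x → d ≤ L b x → d ≤ keptBelow b x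
    helper b rec x enough with any? (λ l → toℕ l <? b ×-dec d ≤? L (toℕ l) (w l) ×-dec w l <? x)
    ... | yes (l , l<b , nonKept-l , wl<x) =
      ≤-trans (rec l<b (w l) nonKept-l)
        (count-mono _ _ (allFin n) λ _ (k<l , kept-k , wk<wl) → <-trans k<l l<b , kept-k , <-trans wk<wl wl<x)
    ... | no none = ≤-trans enough (count-mono _ _ (allFin n) λ {k} _ (k<b , wk<x) → k<b , kept-k k k<b wk<x , wk<x)
      where
      kept-k : ∀ k → toℕ k < b → w k < x → Kept k
      kept-k k k<b wk<x = ≰⇒> λ nonKept-k → none (k , k<b , nonKept-k , wk<x)

  σ-nonKept-high : ∀ {i} → NonKept i → d ≤ lowerBefore σ (toℕ i) (σ i)
  σ-nonKept-high {i} nonKept-i = ≤-trans (kept-suffice (toℕ i) (σ i) (σ-high nonKept-i))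
    (count-mono _ _ (allFin n) λ _ (k<i , kept-k , wk<σi) → k<i , subst (_< σ i) (sym (σ-kept kept-k)) wk<σi)

  -- an entry before a kept position i lying below σ i = w i cannot be non-kept
  σ-kept-low : ∀ {i} → Kept i → lowerBefore σ (toℕ i) (σ i) < d
  σ-kept-low {i} kept-i = ≤-<-trans (count-mono _ _ (allFin n) below) kept-i
    where
    below : ∀ {k} → k ∈ allFin n → toℕ k < toℕ i × σ k < σ i → toℕ k < toℕ i × w k < w i
    below {k} _ (k<i , σk<σi) with kept? k
    ... | yes kept-k = k<i , subst₂ _<_ (σ-kept kept-k) (σ-kept kept-i) σk<σi
    ... | no ¬kept-k = contradiction (subst (σ k <_) (σ-kept kept-i) σk<σi)
      (<-asym (separates (≤-<-trans (L-mono-bound (w i) (<⇒≤ k<i)) kept-i) (σ-high (≮⇒≥ ¬kept-k))))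

  no-inversion-at-kept : ∀ {i j} → Kept i → ¬ HighInversion d w i j
  no-inversion-at-kept kept-i (_ , wj<wi , enough) = <⇒≱ (≤-<-trans (L-mono-value _ (<⇒≤ wj<wi)) kept-i) enough

  σ-larger-later : ∀ {r} → NonKept r → count (largerLater? σ r) (allFin n) ≡ e r
  σ-larger-later {r} nonKept-r = begin
    count (largerLater? σ r) (allFin n)
      ≡⟨ count-cong _ _ (allFin n) (λ _ later → Equivalence.from nonKept-⇔ (later-nonKept later) , later) (λ _ → proj₂) ⟩
    count (λ j → T? (not (kept j)) ×-dec largerLater? σ r j) (allFin n)
      ≡⟨ count-filter (T? ∘ (not ∘ kept)) (largerLater? σ r) (allFin n) ⟨
    count (largerLater? σ r) nonKept
      ≡⟨ count-cong _ _ nonKept (λ j∈ (r<j , lt) → r<j , subst₂ _<_ (σ≡σ′ r∈) (σ≡σ′ j∈) lt)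
                                (λ j∈ (r<j , lt) → r<j , subst₂ _<_ (sym (σ≡σ′ r∈)) (sym (σ≡σ′ j∈)) lt) ⟩
    count (largerLater? (σ′ nonKept freeVals) r) nonKept
      ≡⟨ larger-later r∈ ⟩
    e r ∎
    where
    open ≡-Reasoning
    r∈ : r ∈ nonKept
    r∈ = Equivalence.from ∈-nonKept nonKept-r
    σ≡σ′ : ∀ {k} → k ∈ nonKept → σ k ≡ σ′ nonKept freeVals k
    σ≡σ′ = σ-nonKept ∘ Equivalence.to ∈-nonKept
    later-nonKept : ∀ {j} → toℕ r < toℕ j × σ r < σ j → NonKept j
    later-nonKept {j} (r<j , σr<σj) = ≮⇒≥ λ kept-j → <-asym (subst (σ r <_) (σ-kept kept-j) σr<σj)
      (separates (≤-<-trans (L-mono-bound (w j) (<⇒≤ r<j)) kept-j) (σ-high nonKept-r))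

  ascents-per-row : ∀ i → count (highAscent? d σ i) (allFin n) ≡ e i
  ascents-per-row i with kept? i
  ... | yes kept-i = begin
    count (highAscent? d σ i) (allFin n)     ≡⟨ count-none _ (allFin n) (λ _ (_ , _ , enough) → <⇒≱ (σ-kept-low kept-i) enough) ⟩
    0                                        ≡⟨ count-none _ (allFin n) (λ _ → no-inversion-at-kept kept-i) ⟨
    count (highInversion? d w i) (allFin n)  ≡⟨ e≡inversions i ⟨
    e i                                      ∎
    where open ≡-Reasoning
  ... | no ¬kept-i = trans
    (count-⇔ (highAscent? d σ i) (largerLater? σ i)
      (mk⇔ (λ (i<j , σi<σj , _) → i<j , σi<σj) (λ (i<j , σi<σj) → i<j , σi<σj , σ-nonKept-high (≮⇒≥ ¬kept-i))) (allFin n))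
    (σ-larger-later (≮⇒≥ ¬kept-i))
proposition6 : (m n : ℕ) → 2 ≤ m → 1 ≤ n → (π : Permutation′ n) →
    Σ ℕ (λ k → HasCount (APair m (seq π)) k × HasCount (BPair m (Φ m π)) k)
proposition6 (suc (suc d)) n (s≤s (s≤s z≤n)) _ π =
  sum (map e (allFin n)) ,
  HasCount-rows (highInversion? d w) (APair-⇔ w d w-injective) (sym ∘ e≡inversions) ,
  HasCount-rows (highAscent? d σ) (BPair-⇔ σ d σ-injective) ascents-per-row
  where
  open Analysis d π
  open PhiDef (2 + d) π using (e)
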